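{- Define integers $B_3(n,k,l)$, for $n\ge 1$ and $k,l\ge 0$, by: $B_3(1,0,0)=1$; for $n>1$ and $k+l<n$, $B_3(n,k,l)=\sum_{0\le i\le k,\ 0\le j\le l} B_3(n-1,i,j)$; and $B_3(n,k,l)=0$ whenever $k+l\ge n$. Then for every $n>0$, $$\sum_{k,l\ge 0} B_3(n,k,l)=C_3(n)=\frac{1}{2n+1}\binom{3n}{n}.$$ Moreover, for all $n\ge 1$ and $k,l\ge 0$ with $k+l<n$, $B_3(n,k,l)$ equals the cardinality of $\mathcal{D}_{n,k,l}$.
   Context: A 2-Dyck path of length $3n$ is a lattice path from $(0,0)$ to $(3n,0)$ using up steps $(1,1)$ and down steps $(1,-2)$ that never goes below the line $y=0$ (it has $2n$ up steps and $n$ down steps). The height of a down step is the $y$-coordinate of its end-point. The last down sequence of a nonempty 2-Dyck path is the final maximal run of consecutive down steps (the down steps after the last up step). $\mathcal{D}_{n,k,l}$ denotes the set of 2-Dyck paths of length $3n$ which, among the down steps not belonging to the last down sequence, have exactly $k$ down steps at even height and exactly $l$ down steps at odd height (so the last down sequence has length $n-k-l$). -}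

module Defs where

open import Data.Nat using (ℕ; zero; suc; _+_; _*_; _<ᵇ_; _/_)
open import Data.Nat.Combinatorics using (_C_)
open import Data.Bool using (Bool; true; false; if_then_else_; T)
open import Data.List using (List; []; _∷_; map; upTo)
open import Data.Nat.ListAction using (sum)
open import Data.Vec using (Vec; toList)
open import Data.Product using (Σ; _×_; _,_)
open import Relation.Binary.PropositionalEquality using (_≡_)

Σ≤ : ℕ → (ℕ → ℕ) → ℕ
Σ≤ k f = sum (map f (upTo (suc k)))

-- B₃(n,k,l).  B₃(0,_,_) is irrelevant (the paper only uses n ≥ 1); set to 0.
B3 : ℕ → ℕ → ℕ → ℕ
B3 zero k l = 0
B3 (suc zero) zero zero = 1
B3 (suc zero) _ _ = 0
B3 (suc (suc m)) k l =
  if (k + l) <ᵇ suc (suc m)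
  then Σ≤ k (λ i → Σ≤ l (λ j → B3 (suc m) i j))
  else 0

-- Σ_{k,l ≥ 0} B₃(n,k,l); terms with k + l ≥ n vanish, so k,l ≤ n suffices.
totalB3 : ℕ → ℕ
totalB3 n = Σ≤ n (λ k → Σ≤ n (λ l → B3 n k l))

C3 : ℕ → ℕ
C3 n = ((3 * n) C n) / suc (2 * n)

-- Steps: U = (1,1), D = (1,-2)
data Step : Set where
  U D : Step

validFrom : ℕ → List Step → Bool
validFrom zero [] = true
validFrom (suc _) [] = false
validFrom h (U ∷ s) = validFrom (suc h) s
validFrom (suc (suc h)) (D ∷ s) = validFrom h s
validFrom _ (D ∷ _) = false

TwoDyck : ℕ → Set
TwoDyck n = Σ (Vec Step (3 * n)) λ p → T (validFrom 0 (toList p))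

hasU : List Step → Bool
hasU [] = false
hasU (U ∷ _) = true
hasU (D ∷ s) = hasU s

isEven : ℕ → Bool
isEven zero = true
isEven (suc zero) = false
isEven (suc (suc n)) = isEven n

-- (number of down steps at even height, number at odd height), counting only
-- down steps NOT in the last down sequence (i.e. followed later by some U step).
-- The height of a down step is the height of its end point.
downCounts : ℕ → List Step → ℕ × ℕ
downCounts h [] = (0 , 0)
downCounts h (U ∷ s) = downCounts (suc h) s
downCounts zero (D ∷ s) = downCounts zero s            -- not reached for valid paths
downCounts (suc zero) (D ∷ s) = downCounts zero s      -- not reached for valid paths
downCounts (suc (suc h)) (D ∷ s) with downCounts h s
... | (e , o) =
  if hasU s
  then (if isEven h then (suc e , o) else (e , suc o))
  else (e , o)

𝒟 : ℕ → ℕ → ℕ → Set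
𝒟 n k l = Σ (TwoDyck n) λ p → downCounts 0 (toList (Σ.proj₁ p)) ≡ (k , l)

module Submission where

-- Read backwards, a 2-Dyck path starts with its last down sequence. If a path of length 3n ends
-- in U D^t, replacing that suffix by U D^a U D^b U D^(c+1) gives a path of length 3(n+1) with
-- a more down steps at even height and b more at odd height outside the last down sequence;
-- conversely every path of length 3(n+1), n ≥ 1, ends in some U D^a U D^b U D^(c+1) and
-- arises in this way from exactly one path. Taking a = k − i, b = l − j and c = n − k − l
-- identifies 𝒟_{n+1,k,l} with the disjoint union of the 𝒟_{n,i,j} over i ≤ k, j ≤ l, which
-- is the recurrence defining B₃. Summing over k and l counts all 2-Dyck paths, and an
-- induction on length shows that there are C(g+3d, d) − 2·C(g+3d, d−1) paths of length g + 3d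
-- from height g down to 0; for g = 0 and d = n this is C₃(n).

open import Defs
open import Axiom.UniquenessOfIdentityProofs using (module Decidable⇒UIP)
open import Data.Bool using (Bool; true; false; if_then_else_; T; _∨_)
open import Data.Bool.Properties using (T-irrelevant; ∨-zeroʳ; ∨-identityʳ)
open import Data.Empty using (⊥-elim)
open import Data.Fin using (Fin; toℕ; fromℕ<) renaming (zero to 0F; suc to 1+F)
open import Data.Fin.Permutation using (↔⇒≡)
open import Data.Fin.Properties using (toℕ-injective; toℕ-fromℕ<; toℕ≤pred[n]; +↔⊎)
open import Data.List using (List; []; _∷_; _++_; [_]; reverse; length; replicate; applyUpTo)
open import Data.List.Properties
  using (length-++; length-replicate; length-reverse; map-upTo; reverse-involutive; unfold-reverse)
open import Data.Nat
open import Data.Nat.Combinatorics using (_C_; nCk+nC[k+1]≡[n+1]C[k+1]; nC1≡n)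
open import Data.Nat.DivMod using (m*n/n≡m)
open import Data.Nat.ListAction using (sum)
open import Data.Nat.Properties
open import Data.Nat.Tactic.RingSolver using (solve-∀)
open import Data.Product using (Σ; _×_; _,_; proj₁; proj₂)
open import Data.Product.Function.Dependent.Propositional using (Σ-↔)
open import Data.Product.Properties using (≡-dec)
open import Data.Sum using (_⊎_; inj₁; inj₂)
open import Data.Sum.Function.Propositional using (_⊎-↔_)
open import Data.Unit using (tt)
open import Data.Vec using (Vec; toList; fromList; cast)
open import Data.Vec.Properties using (toList-injective; toList-cast; toList∘fromList; cast-is-id; length-toList)
open import Function using (_∘_)
open import Function.Bundles using (_↔_; mk↔ₛ′)
open import Function.Properties.Inverse using (↔-refl; ↔-sym; ↔-trans)
open import Function.Related.Propositional using (module EquationalReasoning)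
open import Relation.Binary.PropositionalEquality hiding ([_])
open import Relation.Nullary using (¬_; yes; no; Irrelevant)

Σ-≡-irrelevant : ∀ {A : Set} {P : A → Set} → (∀ {a} → Irrelevant (P a)) →
  {x y : Σ A P} → proj₁ x ≡ proj₁ y → x ≡ y
Σ-≡-irrelevant irrelevant {a , p} {.a , q} refl = cong (a ,_) (irrelevant p q)

×-irrelevant : ∀ {A B : Set} → Irrelevant A → Irrelevant B → Irrelevant (A × B)
×-irrelevant irrA irrB (a , b) (a′ , b′) = cong₂ _,_ (irrA a a′) (irrB b b′)

≡-irrelevant-ℕ×ℕ : {p q : ℕ × ℕ} → Irrelevant (p ≡ q)
≡-irrelevant-ℕ×ℕ = Decidable⇒UIP.≡-irrelevant (≡-dec _≟_ _≟_)

_≤²_ : ℕ × ℕ → ℕ × ℕ → Set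
(i , j) ≤² (k , l) = i ≤ k × j ≤ l

≤²-irrelevant : ∀ {p q} → Irrelevant (p ≤² q)
≤²-irrelevant = ×-irrelevant ≤-irrelevant ≤-irrelevant

Fin0↔ : ∀ {A : Set} → ¬ A → Fin 0 ↔ A
Fin0↔ ¬a = mk↔ₛ′ (λ ()) (λ a → ⊥-elim (¬a a)) (λ a → ⊥-elim (¬a a)) (λ ())

Σ-fst↔ : ∀ {X : Set} {P : X → Set} → (∀ x → P x) → (∀ {x} → Irrelevant (P x)) → Σ X P ↔ X
Σ-fst↔ p irrelevant = mk↔ₛ′ proj₁ (λ x → x , p x) (λ _ → refl) (λ _ → Σ-≡-irrelevant irrelevant refl)

Σ-Fin-suc↔⊎ : ∀ {n} (P : Fin (suc n) → Set) → Σ (Fin (suc n)) P ↔ (P 0F ⊎ Σ (Fin n) (λ i → P (1+F i)))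
Σ-Fin-suc↔⊎ P = mk↔ₛ′ to from to∘from from∘to
  where
  to : Σ (Fin _) P → P 0F ⊎ Σ (Fin _) (λ i → P (1+F i))
  to (0F , p) = inj₁ p
  to (1+F i , p) = inj₂ (i , p)
  from : P 0F ⊎ Σ (Fin _) (λ i → P (1+F i)) → Σ (Fin _) P
  from (inj₁ p) = 0F , p
  from (inj₂ (i , p)) = 1+F i , p
  to∘from : ∀ y → to (from y) ≡ y
  to∘from (inj₁ p) = refl
  to∘from (inj₂ (i , p)) = refl
  from∘to : ∀ x → from (to x) ≡ x
  from∘to (0F , p) = refl
  from∘to (1+F i , p) = refl

Fin-sum-applyUpTo↔Σ : ∀ n (f : ℕ → ℕ) → Fin (sum (applyUpTo f n)) ↔ Σ (Fin n) (λ i → Fin (f (toℕ i)))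
Fin-sum-applyUpTo↔Σ zero f = mk↔ₛ′ (λ ()) (λ ()) (λ ()) (λ ())
Fin-sum-applyUpTo↔Σ (suc n) f = begin
  Fin (f 0 + sum (applyUpTo (f ∘ suc) n))              ↔⟨ +↔⊎ ⟩
  (Fin (f 0) ⊎ Fin (sum (applyUpTo (f ∘ suc) n)))      ↔⟨ ↔-refl ⊎-↔ Fin-sum-applyUpTo↔Σ n (f ∘ suc) ⟩
  (Fin (f 0) ⊎ Σ (Fin n) (λ i → Fin (f (suc (toℕ i))))) ↔⟨ Σ-Fin-suc↔⊎ (λ i → Fin (f (toℕ i))) ⟨
  Σ (Fin (suc n)) (λ i → Fin (f (toℕ i)))               ∎
  where open EquationalReasoning

Fin-Σ≤↔Σ : ∀ k (f : ℕ → ℕ) → Fin (Σ≤ k f) ↔ Σ (Fin (suc k)) (λ i → Fin (f (toℕ i)))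
Fin-Σ≤↔Σ k f = subst (λ s → Fin s ↔ Σ (Fin (suc k)) (λ i → Fin (f (toℕ i))))
  (cong sum (sym (map-upTo f (suc k)))) (Fin-sum-applyUpTo↔Σ (suc k) f)

Fin-Σ≤²↔Σ : ∀ k l (f : ℕ → ℕ → ℕ) {A : ℕ → ℕ → Set} → (∀ i j → Fin (f i j) ↔ A i j) →
  Fin (Σ≤ k λ i → Σ≤ l (f i)) ↔ Σ (Fin (suc k)) λ i → Σ (Fin (suc l)) λ j → A (toℕ i) (toℕ j)
Fin-Σ≤²↔Σ k l f {A} fA = ↔-trans (Fin-Σ≤↔Σ k _) (Σ-↔ ↔-refl (λ {i} →
  ↔-trans (Fin-Σ≤↔Σ l (f (toℕ i))) (Σ-↔ ↔-refl (λ {j} → fA (toℕ i) (toℕ j)))))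

Σ-Fin²-fibres↔≤² : ∀ {X : Set} (c : X → ℕ × ℕ) k l →
  Σ (Fin (suc k)) (λ i → Σ (Fin (suc l)) λ j → Σ X λ x → c x ≡ (toℕ i , toℕ j))
    ↔ Σ X (λ x → c x ≤² (k , l))
Σ-Fin²-fibres↔≤² {X} c k l = mk↔ₛ′ to from to∘from from∘to
  where
  Fibres = Σ (Fin (suc k)) λ i → Σ (Fin (suc l)) λ j → Σ X λ x → c x ≡ (toℕ i , toℕ j)

  to : Fibres → Σ X (λ x → c x ≤² (k , l))
  to (i , j , x , e) = x , subst (_≤ k) (sym (cong proj₁ e)) (toℕ≤pred[n] i)
                         , subst (_≤ l) (sym (cong proj₂ e)) (toℕ≤pred[n] j)

  from : Σ X (λ x → c x ≤² (k , l)) → Fibres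
  from (x , i≤k , j≤l) = fromℕ< (s≤s i≤k) , fromℕ< (s≤s j≤l) , x
                       , sym (cong₂ _,_ (toℕ-fromℕ< (s≤s i≤k)) (toℕ-fromℕ< (s≤s j≤l)))

  to∘from : ∀ y → to (from y) ≡ y
  to∘from y = Σ-≡-irrelevant ≤²-irrelevant refl

  fibre-≡ : ∀ {i i′ j j′ x e e′} → toℕ i ≡ toℕ i′ → toℕ j ≡ toℕ j′ →
    _≡_ {A = Fibres} (i , j , x , e) (i′ , j′ , x , e′)
  fibre-≡ {i} {j = j} {x = x} {e} {e′} i≡ j≡ with toℕ-injective i≡ | toℕ-injective j≡
  ... | refl | refl = cong (λ e → i , j , x , e) (≡-irrelevant-ℕ×ℕ e e′)

  from∘to : ∀ y → from (to y) ≡ y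
  from∘to (i , j , x , e) =
    fibre-≡ (trans (toℕ-fromℕ< _) (cong proj₁ e)) (trans (toℕ-fromℕ< _) (cong proj₂ e))

toList-injective-≡ : ∀ {A : Set} {n} (u v : Vec A n) → toList u ≡ toList v → u ≡ v
toList-injective-≡ u v eq = trans (sym (cast-is-id refl u)) (toList-injective refl u v eq)

toList-cast-fromList : ∀ {A : Set} {n} (xs : List A) .(eq : length xs ≡ n) → toList (cast eq (fromList xs)) ≡ xs
toList-cast-fromList xs eq = trans (toList-cast eq (fromList xs)) (toList∘fromList xs)

if-true : ∀ {A : Set} {b} {x y : A} → T b → (if b then x else y) ≡ x
if-true {b = true} _ = refl

if-false : ∀ {A : Set} {b} {x y : A} → ¬ T b → (if b then x else y) ≡ y
if-false {b = true} ¬t = ⊥-elim (¬t tt)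
if-false {b = false} _ = refl

∸-gaps-sum : ∀ {i j k l s t} → i ≤ k → j ≤ l → k + l ≤ s → i + j + t ≡ s →
  (k ∸ i) + (l ∸ j) + (s ∸ (k + l)) ≡ t
∸-gaps-sum {i} {j} {t = t} i≤k j≤l kl≤s eq
  with m≤n⇒∃[o]m+o≡n i≤k | m≤n⇒∃[o]m+o≡n j≤l | m≤n⇒∃[o]m+o≡n kl≤s
... | a , refl | b , refl | c , refl
  rewrite m+n∸m≡n i a | m+n∸m≡n j b | m+n∸m≡n (i + a + (j + b)) c =
  +-cancelˡ-≡ (i + j) (a + b + c) t (trans (regroup i j a b c) (sym eq))
  where
  regroup : ∀ i j a b c → i + j + (a + b + c) ≡ i + a + (j + b) + c
  regroup = solve-∀

∸-gap-recover : ∀ {a b c i j s} → i + j + (a + b + c) ≡ s → s ∸ ((a + i) + (b + j)) ≡ c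
∸-gap-recover {a} {b} {c} {i} {j} refl =
  trans (cong (_∸ (a + i + (b + j))) (regroup a b c i j)) (m+n∸m≡n (a + i + (b + j)) c)
  where
  regroup : ∀ a b c i j → i + j + (a + b + c) ≡ a + i + (b + j) + c
  regroup = solve-∀

-- Reading paths backwards

-- validRev h g r: reverse r is a path from height h to height g that never goes below 0.
-- The list is read from its end at height g, so a step D read backwards climbs by 2.
validRev : ℕ → ℕ → List Step → Bool
validRev h g [] = g ≡ᵇ h
validRev h g (D ∷ r) = validRev h (2 + g) r
validRev h zero (U ∷ r) = false
validRev h (suc g) (U ∷ r) = validRev h g r

validRev-∷ʳ-U : ∀ h g r → validRev h g (r ++ [ U ]) ≡ validRev (suc h) g r
validRev-∷ʳ-U h zero [] = refl
validRev-∷ʳ-U h (suc g) [] = refl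
validRev-∷ʳ-U h g (D ∷ r) = validRev-∷ʳ-U h (2 + g) r
validRev-∷ʳ-U h zero (U ∷ r) = refl
validRev-∷ʳ-U h (suc g) (U ∷ r) = validRev-∷ʳ-U h g r

validRev-∷ʳ-D : ∀ h g r → validRev (2 + h) g (r ++ [ D ]) ≡ validRev h g r
validRev-∷ʳ-D h g [] = refl
validRev-∷ʳ-D h g (D ∷ r) = validRev-∷ʳ-D h (2 + g) r
validRev-∷ʳ-D h zero (U ∷ r) = refl
validRev-∷ʳ-D h (suc g) (U ∷ r) = validRev-∷ʳ-D h g r

validRev-∷ʳ-D-low : ∀ {h} g r → h < 2 → validRev h g (r ++ [ D ]) ≡ false
validRev-∷ʳ-D-low g [] (s≤s z≤n) = refl
validRev-∷ʳ-D-low g [] (s≤s (s≤s z≤n)) = refl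
validRev-∷ʳ-D-low g (D ∷ r) h<2 = validRev-∷ʳ-D-low (2 + g) r h<2
validRev-∷ʳ-D-low zero (U ∷ r) h<2 = refl
validRev-∷ʳ-D-low (suc g) (U ∷ r) h<2 = validRev-∷ʳ-D-low g r h<2

validFrom-U : ∀ h s → validFrom h (U ∷ s) ≡ validFrom (suc h) s
validFrom-U zero s = refl
validFrom-U (suc h) s = refl

validFrom≡validRev-reverse : ∀ h s → validFrom h s ≡ validRev h 0 (reverse s)
validFrom≡validRev-reverse zero [] = refl
validFrom≡validRev-reverse (suc h) [] = refl
validFrom≡validRev-reverse h (U ∷ s) = begin
  validFrom h (U ∷ s)                 ≡⟨ validFrom-U h s ⟩
  validFrom (suc h) s                 ≡⟨ validFrom≡validRev-reverse (suc h) s ⟩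
  validRev (suc h) 0 (reverse s)      ≡⟨ validRev-∷ʳ-U h 0 (reverse s) ⟨
  validRev h 0 (reverse s ++ [ U ])   ≡⟨ cong (validRev h 0) (unfold-reverse U s) ⟨
  validRev h 0 (reverse (U ∷ s))      ∎
  where open ≡-Reasoning
validFrom≡validRev-reverse (suc (suc h)) (D ∷ s) = begin
  validFrom h s                            ≡⟨ validFrom≡validRev-reverse h s ⟩
  validRev h 0 (reverse s)                 ≡⟨ validRev-∷ʳ-D h 0 (reverse s) ⟨
  validRev (2 + h) 0 (reverse s ++ [ D ])  ≡⟨ cong (validRev (2 + h) 0) (unfold-reverse D s) ⟨
  validRev (2 + h) 0 (reverse (D ∷ s))     ∎
  where open ≡-Reasoning
validFrom≡validRev-reverse zero (D ∷ s) =
  trans (sym (validRev-∷ʳ-D-low 0 (reverse s) (s≤s z≤n))) (cong (validRev 0 0) (sym (unfold-reverse D s)))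
validFrom≡validRev-reverse (suc zero) (D ∷ s) =
  trans (sym (validRev-∷ʳ-D-low 0 (reverse s) (s≤s (s≤s z≤n)))) (cong (validRev 1 0) (sym (unfold-reverse D s)))

bump : Bool → ℕ × ℕ → ℕ × ℕ
bump true (e , o) = suc e , o
bump false (e , o) = e , suc o

bumpIf : Bool → Bool → ℕ × ℕ → ℕ × ℕ
bumpIf counted even p = if counted then bump even p else p

bumpIf-comm : ∀ c e c′ e′ p → bumpIf c e (bumpIf c′ e′ p) ≡ bumpIf c′ e′ (bumpIf c e p)
bumpIf-comm false e c′ e′ p = refl
bumpIf-comm true e false e′ p = refl
bumpIf-comm true true true true p = refl
bumpIf-comm true true true false p = refl
bumpIf-comm true false true true p = refl
bumpIf-comm true false true false p = refl

-- The flag records whether an up step has been read, i.e. whether the current down step lies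
-- before some up step of the forward path and so outside the last down sequence.
countsRev : Bool → ℕ → List Step → ℕ × ℕ
countsRev seenU g [] = 0 , 0
countsRev seenU g (U ∷ r) = countsRev true (pred g) r
countsRev seenU g (D ∷ r) = bumpIf seenU (isEven g) (countsRev seenU (2 + g) r)

downCounts-D : ∀ h s → downCounts (2 + h) (D ∷ s) ≡ bumpIf (hasU s) (isEven h) (downCounts h s)
downCounts-D h s with downCounts h s | hasU s | isEven h
... | _ | true | true = refl
... | _ | true | false = refl
... | _ | false | _ = refl

hasU-++ : ∀ xs ys → hasU (xs ++ ys) ≡ hasU xs ∨ hasU ys
hasU-++ [] ys = refl
hasU-++ (U ∷ xs) ys = refl
hasU-++ (D ∷ xs) ys = hasU-++ xs ys

hasU-reverse : ∀ s → hasU (reverse s) ≡ hasU s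
hasU-reverse [] = refl
hasU-reverse (x ∷ s) rewrite unfold-reverse x s | hasU-++ (reverse s) [ x ] | hasU-reverse s with x
... | U = ∨-zeroʳ (hasU s)
... | D = ∨-identityʳ (hasU s)

countsRev-∷ʳ-U : ∀ f g r → countsRev f g (r ++ [ U ]) ≡ countsRev f g r
countsRev-∷ʳ-U f g [] = refl
countsRev-∷ʳ-U f g (U ∷ r) = countsRev-∷ʳ-U true (pred g) r
countsRev-∷ʳ-U f g (D ∷ r) = cong (bumpIf f (isEven g)) (countsRev-∷ʳ-U f (2 + g) r)

countsRev-∷ʳ-D : ∀ h f g r → T (validRev h g r) →
  countsRev f g (r ++ [ D ]) ≡ bumpIf (f ∨ hasU r) (isEven h) (countsRev f g r)
countsRev-∷ʳ-D h f g [] valid rewrite ≡ᵇ⇒≡ g h valid | ∨-identityʳ f = refl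
countsRev-∷ʳ-D h f (suc g) (U ∷ r) valid rewrite ∨-zeroʳ f = countsRev-∷ʳ-D h true g r valid
countsRev-∷ʳ-D h f g (D ∷ r) valid = begin
  bumpIf f (isEven g) (countsRev f (2 + g) (r ++ [ D ]))
    ≡⟨ cong (bumpIf f (isEven g)) (countsRev-∷ʳ-D h f (2 + g) r valid) ⟩
  bumpIf f (isEven g) (bumpIf (f ∨ hasU r) (isEven h) (countsRev f (2 + g) r))
    ≡⟨ bumpIf-comm f (isEven g) (f ∨ hasU r) (isEven h) _ ⟩
  bumpIf (f ∨ hasU r) (isEven h) (countsRev f g (D ∷ r)) ∎
  where open ≡-Reasoning

downCounts≡countsRev-reverse : ∀ h s → T (validFrom h s) → downCounts h s ≡ countsRev false 0 (reverse s)
downCounts≡countsRev-reverse zero [] valid = refl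
downCounts≡countsRev-reverse h (U ∷ s) valid = begin
  downCounts (suc h) s                    ≡⟨ downCounts≡countsRev-reverse (suc h) s (subst T (validFrom-U h s) valid) ⟩
  countsRev false 0 (reverse s)           ≡⟨ countsRev-∷ʳ-U false 0 (reverse s) ⟨
  countsRev false 0 (reverse s ++ [ U ])  ≡⟨ cong (countsRev false 0) (unfold-reverse U s) ⟨
  countsRev false 0 (reverse (U ∷ s))     ∎
  where open ≡-Reasoning
downCounts≡countsRev-reverse (suc (suc h)) (D ∷ s) valid = begin
  downCounts (2 + h) (D ∷ s)                                  ≡⟨ downCounts-D h s ⟩
  bumpIf (hasU s) (isEven h) (downCounts h s)
    ≡⟨ cong₂ (λ u p → bumpIf u (isEven h) p) (sym (hasU-reverse s)) (downCounts≡countsRev-reverse h s valid) ⟩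
  bumpIf (hasU (reverse s)) (isEven h) (countsRev false 0 (reverse s))
    ≡⟨ countsRev-∷ʳ-D h false 0 (reverse s) validRev-s ⟨
  countsRev false 0 (reverse s ++ [ D ])                      ≡⟨ cong (countsRev false 0) (unfold-reverse D s) ⟨
  countsRev false 0 (reverse (D ∷ s))                         ∎
  where
  open ≡-Reasoning
  validRev-s : T (validRev h 0 (reverse s))
  validRev-s = subst T (validFrom≡validRev-reverse h s) valid

RevPath : ℕ → ℕ → Set
RevPath L g = Σ (List Step) λ r → length r ≡ L × T (validRev 0 g r)

RevPath-≡ : ∀ {L g} {p q : RevPath L g} → proj₁ p ≡ proj₁ q → p ≡ q
RevPath-≡ = Σ-≡-irrelevant (×-irrelevant ≡-irrelevant T-irrelevant)

counts : List Step → ℕ × ℕ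
counts = countsRev false 0

𝒟R : ℕ → ℕ → ℕ → Set
𝒟R n k l = Σ (RevPath (3 * n) 0) λ p → counts (proj₁ p) ≡ (k , l)

𝒟R-≡ : ∀ {n k l} {x y : 𝒟R n k l} → proj₁ (proj₁ x) ≡ proj₁ (proj₁ y) → x ≡ y
𝒟R-≡ eq = Σ-≡-irrelevant ≡-irrelevant-ℕ×ℕ (RevPath-≡ eq)

𝒟↔𝒟R : ∀ n k l → 𝒟 n k l ↔ 𝒟R n k l
𝒟↔𝒟R n k l = mk↔ₛ′ to from to∘from from∘to
  where
  to : 𝒟 n k l → 𝒟R n k l
  to ((v , valid) , e) =
    (reverse (toList v) , trans (length-reverse (toList v)) (length-toList v)
      , subst T (validFrom≡validRev-reverse 0 (toList v)) valid)
    , trans (sym (downCounts≡countsRev-reverse 0 (toList v) valid)) e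

  from : 𝒟R n k l → 𝒟 n k l
  from ((r , len , valid) , e) = (v , valid-v) , e-v
    where
    v : Vec Step (3 * n)
    v = cast (trans (length-reverse r) len) (fromList (reverse r))
    toList-v : toList v ≡ reverse r
    toList-v = toList-cast-fromList (reverse r) _
    valid-v : T (validFrom 0 (toList v))
    valid-v = subst T (sym (begin
      validFrom 0 (toList v)              ≡⟨ cong (validFrom 0) toList-v ⟩
      validFrom 0 (reverse r)             ≡⟨ validFrom≡validRev-reverse 0 (reverse r) ⟩
      validRev 0 0 (reverse (reverse r))  ≡⟨ cong (validRev 0 0) (reverse-involutive r) ⟩
      validRev 0 0 r                      ∎)) valid
      where open ≡-Reasoning
    e-v : downCounts 0 (toList v) ≡ (k , l)
    e-v = begin
      downCounts 0 (toList v)                  ≡⟨ downCounts≡countsRev-reverse 0 (toList v) valid-v ⟩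
      counts (reverse (toList v))              ≡⟨ cong (λ s → counts (reverse s)) toList-v ⟩
      counts (reverse (reverse r))             ≡⟨ cong counts (reverse-involutive r) ⟩
      counts r                                 ≡⟨ e ⟩
      (k , l)                                  ∎
      where open ≡-Reasoning

  to∘from : ∀ x → to (from x) ≡ x
  to∘from ((r , _) , _) =
    𝒟R-≡ {n} (trans (cong reverse (toList-cast-fromList {n = 3 * n} (reverse r) _)) (reverse-involutive r))

  from∘to : ∀ x → from (to x) ≡ x
  from∘to ((v , _) , _) = Σ-≡-irrelevant ≡-irrelevant-ℕ×ℕ (Σ-≡-irrelevant T-irrelevant
    (toList-injective-≡ _ v (trans (toList-cast-fromList _ _) (reverse-involutive (toList v)))))

downSteps upSteps lastDescent : List Step → ℕ
downSteps [] = 0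
downSteps (D ∷ r) = suc (downSteps r)
downSteps (U ∷ r) = downSteps r
upSteps [] = 0
upSteps (D ∷ r) = upSteps r
upSteps (U ∷ r) = suc (upSteps r)
lastDescent [] = 0
lastDescent (D ∷ r) = suc (lastDescent r)
lastDescent (U ∷ r) = 0

length≡downSteps+upSteps : ∀ r → length r ≡ downSteps r + upSteps r
length≡downSteps+upSteps [] = refl
length≡downSteps+upSteps (D ∷ r) = cong suc (length≡downSteps+upSteps r)
length≡downSteps+upSteps (U ∷ r) = trans (cong suc (length≡downSteps+upSteps r)) (sym (+-suc (downSteps r) (upSteps r)))

validRev-balance : ∀ h g r → T (validRev h g r) → g + 2 * downSteps r ≡ h + upSteps r
validRev-balance h g [] valid = cong (_+ 0) (≡ᵇ⇒≡ g h valid)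
validRev-balance h g (D ∷ r) valid = trans (shuffle g (downSteps r)) (validRev-balance h (2 + g) r valid)
  where
  shuffle : ∀ g d → g + 2 * suc d ≡ 2 + g + 2 * d
  shuffle = solve-∀
validRev-balance h (suc g) (U ∷ r) valid = trans (cong suc (validRev-balance h g r valid)) (sym (+-suc h (upSteps r)))

size : ℕ × ℕ → ℕ
size (k , l) = k + l

size-bump : ∀ e p → size (bump e p) ≡ suc (size p)
size-bump true p = refl
size-bump false (k , l) = +-suc k l

size-countsRev-true : ∀ g r → size (countsRev true g r) ≡ downSteps r
size-countsRev-true g [] = refl
size-countsRev-true g (U ∷ r) = size-countsRev-true (pred g) r
size-countsRev-true g (D ∷ r) =
  trans (size-bump (isEven g) (countsRev true (2 + g) r)) (cong suc (size-countsRev-true (2 + g) r))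

size-countsRev-false : ∀ g r → size (countsRev false g r) + lastDescent r ≡ downSteps r
size-countsRev-false g [] = refl
size-countsRev-false g (U ∷ r) = trans (+-identityʳ _) (size-countsRev-true (pred g) r)
size-countsRev-false g (D ∷ r) =
  trans (+-suc (size (countsRev false (2 + g) r)) (lastDescent r)) (cong suc (size-countsRev-false (2 + g) r))

lastDescent-pos : ∀ r → T (validRev 0 0 r) → 0 < upSteps r → 0 < lastDescent r
lastDescent-pos (D ∷ r) valid up = s≤s z≤n

module _ {n : ℕ} (p : RevPath (3 * n) 0) where
  private
    r = proj₁ p
    balance : 2 * downSteps r ≡ upSteps r
    balance = validRev-balance 0 0 r (proj₂ (proj₂ p))

  downSteps-RevPath : downSteps r ≡ n
  downSteps-RevPath = *-cancelˡ-≡ (downSteps r) n 3 (begin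
    3 * downSteps r                    ≡⟨ three* (downSteps r) ⟩
    downSteps r + 2 * downSteps r      ≡⟨ cong (downSteps r +_) balance ⟩
    downSteps r + upSteps r            ≡⟨ length≡downSteps+upSteps r ⟨
    length r                           ≡⟨ proj₁ (proj₂ p) ⟩
    3 * n                              ∎)
    where
    open ≡-Reasoning
    three* : ∀ d → 3 * d ≡ d + 2 * d
    three* = solve-∀

  upSteps-RevPath : upSteps r ≡ 2 * n
  upSteps-RevPath = trans (sym balance) (cong (2 *_) downSteps-RevPath)

  counts-lastDescent : size (counts r) + lastDescent r ≡ n
  counts-lastDescent = trans (size-countsRev-false 0 r) downSteps-RevPath

𝒟R-bound : ∀ {n k l} → 𝒟R (suc n) k l → k + l < suc n
𝒟R-bound {n} {k} {l} (p@(r , _ , valid) , e) =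
  subst (k + l <_) (trans (cong (λ q → size q + lastDescent r) (sym e)) (counts-lastDescent p))
    (m<m+n (k + l) (lastDescent-pos r valid (subst (0 <_) (sym (upSteps-RevPath {suc n} p)) (s≤s z≤n))))

-- Replacing the last down sequence

afterDescent : List Step → List Step
afterDescent [] = []
afterDescent (D ∷ r) = afterDescent r
afterDescent (U ∷ r) = r

descend : ℕ → List Step → List Step
descend t r = replicate t D ++ U ∷ r

lastDescent-descend : ∀ t r → lastDescent (descend t r) ≡ t
lastDescent-descend zero r = refl
lastDescent-descend (suc t) r = cong suc (lastDescent-descend t r)

afterDescent-descend : ∀ t r → afterDescent (descend t r) ≡ r
afterDescent-descend zero r = refl
afterDescent-descend (suc t) r = afterDescent-descend t r

descend-lastDescent-afterDescent : ∀ r → 0 < upSteps r → descend (lastDescent r) (afterDescent r) ≡ r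
descend-lastDescent-afterDescent (U ∷ r) _ = refl
descend-lastDescent-afterDescent (D ∷ r) up = cong (D ∷_) (descend-lastDescent-afterDescent r up)

length-descend : ∀ t r → length (descend t r) ≡ t + suc (length r)
length-descend t r = trans (length-++ (replicate t D)) (cong (_+ suc (length r)) (length-replicate t))

2*-suc-+ : ∀ t g → 2 * t + (2 + g) ≡ 2 * suc t + g
2*-suc-+ = solve-∀

isEven-2*+ : ∀ t g → isEven (2 * t + g) ≡ isEven g
isEven-2*+ zero g = refl
isEven-2*+ (suc t) g = trans (cong isEven (sym (2*-suc-+ t g))) (isEven-2*+ t (2 + g))

validRev-descend : ∀ h g t r → validRev h g (descend t r) ≡ validRev h (2 * t + g) (U ∷ r)
validRev-descend h g zero r = refl
validRev-descend h g (suc t) r = trans (validRev-descend h (2 + g) t r) (cong (λ z → validRev h z (U ∷ r)) (2*-suc-+ t g))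

tally : Bool → ℕ → ℕ × ℕ
tally true t = t , 0
tally false t = 0 , t

infixr 5 _⊕_
_⊕_ : ℕ × ℕ → ℕ × ℕ → ℕ × ℕ
(a , b) ⊕ (k , l) = a + k , b + l

countsRev-false-descend : ∀ g t r → countsRev false g (descend t r) ≡ countsRev true (pred (2 * t + g)) r
countsRev-false-descend g zero r = refl
countsRev-false-descend g (suc t) r =
  trans (countsRev-false-descend (2 + g) t r) (cong (λ z → countsRev true (pred z) r) (2*-suc-+ t g))

countsRev-true-descend : ∀ g t r →
  countsRev true g (descend t r) ≡ tally (isEven g) t ⊕ countsRev true (pred (2 * t + g)) r
countsRev-true-descend g zero r with isEven g
... | true = refl
... | false = refl
countsRev-true-descend g (suc t) r = begin
  bump (isEven g) (countsRev true (2 + g) (descend t r))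
    ≡⟨ cong (bump (isEven g)) (countsRev-true-descend (2 + g) t r) ⟩
  bump (isEven g) (tally (isEven g) t ⊕ countsRev true (pred (2 * t + (2 + g))) r)
    ≡⟨ bump-tally (isEven g) t _ ⟩
  tally (isEven g) (suc t) ⊕ countsRev true (pred (2 * t + (2 + g))) r
    ≡⟨ cong (λ z → tally (isEven g) (suc t) ⊕ countsRev true (pred z) r) (2*-suc-+ t g) ⟩
  tally (isEven g) (suc t) ⊕ countsRev true (pred (2 * suc t + g)) r ∎
  where
  open ≡-Reasoning
  bump-tally : ∀ e t p → bump e (tally e t ⊕ p) ≡ tally e (suc t) ⊕ p
  bump-tally true t p = refl
  bump-tally false t p = refl

-- In forward terms: a path ending in U D^(a+b+c) becomes one ending in U D^a U D^b U D^c.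
extend : ℕ → ℕ → ℕ → List Step → List Step
extend a b c r = descend c (descend b (descend a r))

-- The heights met while reading extend a b (suc c) r: the a new down steps end at even
-- heights and the b new down steps at odd heights.
module ExtendHeights where
  height₁ : ∀ c → 2 * suc c + 0 ≡ suc (2 * c + 1)
  height₁ = solve-∀
  height₂ : ∀ b c → 2 * b + (2 * c + 1) ≡ suc (2 * (b + c) + 0)
  height₂ = solve-∀
  height₃ : ∀ a b c → 2 * a + (2 * (b + c) + 0) ≡ 2 * (a + b + c) + 0
  height₃ = solve-∀

validRev-extend : ∀ a b c r → validRev 0 0 (extend a b (suc c) r) ≡ validRev 0 0 (descend (a + b + c) r)
validRev-extend a b c r = begin
  validRev 0 0 (descend (suc c) (descend b (descend a r)))
    ≡⟨ validRev-descend 0 0 (suc c) _ ⟩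
  validRev 0 (2 * suc c + 0) (U ∷ descend b (descend a r))
    ≡⟨ cong (λ z → validRev 0 z (U ∷ descend b (descend a r))) (height₁ c) ⟩
  validRev 0 (2 * c + 1) (descend b (descend a r))
    ≡⟨ validRev-descend 0 _ b _ ⟩
  validRev 0 (2 * b + (2 * c + 1)) (U ∷ descend a r)
    ≡⟨ cong (λ z → validRev 0 z (U ∷ descend a r)) (height₂ b c) ⟩
  validRev 0 (2 * (b + c) + 0) (descend a r)
    ≡⟨ validRev-descend 0 _ a r ⟩
  validRev 0 (2 * a + (2 * (b + c) + 0)) (U ∷ r)
    ≡⟨ cong (λ z → validRev 0 z (U ∷ r)) (height₃ a b c) ⟩
  validRev 0 (2 * (a + b + c) + 0) (U ∷ r)
    ≡⟨ validRev-descend 0 0 (a + b + c) r ⟨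
  validRev 0 0 (descend (a + b + c) r) ∎
  where
  open ≡-Reasoning
  open ExtendHeights

counts-extend : ∀ a b c r → counts (extend a b (suc c) r) ≡ (a , b) ⊕ counts (descend (a + b + c) r)
counts-extend a b c r = begin
  countsRev false 0 (descend (suc c) (descend b (descend a r)))
    ≡⟨ countsRev-false-descend 0 (suc c) _ ⟩
  countsRev true (pred (2 * suc c + 0)) (descend b (descend a r))
    ≡⟨ cong (λ z → countsRev true (pred z) (descend b (descend a r))) (height₁ c) ⟩
  countsRev true (2 * c + 1) (descend b (descend a r))
    ≡⟨ countsRev-true-descend _ b _ ⟩
  tally (isEven (2 * c + 1)) b ⊕ countsRev true (pred (2 * b + (2 * c + 1))) (descend a r)
    ≡⟨ cong₂ (λ e z → tally e b ⊕ countsRev true (pred z) (descend a r)) (isEven-2*+ c 1) (height₂ b c) ⟩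
  tally false b ⊕ countsRev true (2 * (b + c) + 0) (descend a r)
    ≡⟨ cong (tally false b ⊕_) (countsRev-true-descend _ a r) ⟩
  tally false b ⊕ tally (isEven (2 * (b + c) + 0)) a ⊕ countsRev true (pred (2 * a + (2 * (b + c) + 0))) r
    ≡⟨ cong₂ (λ e z → tally false b ⊕ tally e a ⊕ countsRev true (pred z) r) (isEven-2*+ (b + c) 0) (height₃ a b c) ⟩
  tally false b ⊕ tally true a ⊕ countsRev true (pred (2 * (a + b + c) + 0)) r
    ≡⟨ cong (λ p → tally false b ⊕ tally true a ⊕ p) (countsRev-false-descend 0 (a + b + c) r) ⟨
  (a , b) ⊕ counts (descend (a + b + c) r) ∎
  where
  open ≡-Reasoning
  open ExtendHeights

length-extend : ∀ a b c r → length (extend a b (suc c) r) ≡ 3 + length (descend (a + b + c) r)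
length-extend a b c r = begin
  length (descend (suc c) (descend b (descend a r)))
    ≡⟨ length-descend (suc c) _ ⟩
  suc c + suc (length (descend b (descend a r)))
    ≡⟨ cong (λ z → suc c + suc z) (length-descend b _) ⟩
  suc c + suc (b + suc (length (descend a r)))
    ≡⟨ cong (λ z → suc c + suc (b + suc z)) (length-descend a r) ⟩
  suc c + suc (b + suc (a + suc (length r)))
    ≡⟨ regroup a b c (length r) ⟩
  3 + (a + b + c + suc (length r))
    ≡⟨ cong (3 +_) (length-descend (a + b + c) r) ⟨
  3 + length (descend (a + b + c) r) ∎
  where
  open ≡-Reasoning
  regroup : ∀ a b c n → suc c + suc (b + suc (a + suc n)) ≡ 3 + (a + b + c + suc n)
  regroup = solve-∀

upSteps-afterDescent : ∀ r → 0 < upSteps r → upSteps r ≡ suc (upSteps (afterDescent r))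
upSteps-afterDescent (U ∷ r) _ = refl
upSteps-afterDescent (D ∷ r) up = upSteps-afterDescent r up

extend-lastDescents : ∀ R → 2 < upSteps R →
  let R₁ = afterDescent R ; R₂ = afterDescent R₁
  in extend (lastDescent R₂) (lastDescent R₁) (lastDescent R) (afterDescent R₂) ≡ R
extend-lastDescents R up = begin
  descend (lastDescent R) (descend (lastDescent R₁) (descend (lastDescent R₂) (afterDescent R₂)))
    ≡⟨ cong (λ z → descend (lastDescent R) (descend (lastDescent R₁) z)) (descend-lastDescent-afterDescent R₂ up₂) ⟩
  descend (lastDescent R) (descend (lastDescent R₁) R₂)
    ≡⟨ cong (descend (lastDescent R)) (descend-lastDescent-afterDescent R₁ (<-trans (s≤s z≤n) up₁)) ⟩
  descend (lastDescent R) R₁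
    ≡⟨ descend-lastDescent-afterDescent R up₀ ⟩
  R ∎
  where
  open ≡-Reasoning
  R₁ = afterDescent R
  R₂ = afterDescent R₁
  up₀ : 0 < upSteps R
  up₀ = <-trans (s≤s z≤n) (<-trans (s≤s (s≤s z≤n)) up)
  up₁ : 1 < upSteps R₁
  up₁ = s≤s⁻¹ (subst (2 <_) (upSteps-afterDescent R up₀) up)
  up₂ : 0 < upSteps R₂
  up₂ = s≤s⁻¹ (subst (1 <_) (upSteps-afterDescent R₁ (<-trans (s≤s z≤n) up₁)) up₁)

shrink : List Step → List Step
shrink R = descend (lastDescent R₂ + lastDescent R₁ + pred (lastDescent R)) (afterDescent R₂)
  where
  R₁ = afterDescent R
  R₂ = afterDescent R₁

shrink-extend : ∀ a b c r → shrink (extend a b (suc c) r) ≡ descend (a + b + c) r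
shrink-extend a b c r = cong₂ descend (cong₂ _+_ (cong₂ _+_ ℓ₂ ℓ₁) (cong pred (lastDescent-descend (suc c) _))) R₃≡
  where
  R = extend a b (suc c) r
  R₁≡ : afterDescent R ≡ descend b (descend a r)
  R₁≡ = afterDescent-descend (suc c) _
  R₂≡ : afterDescent (afterDescent R) ≡ descend a r
  R₂≡ = trans (cong afterDescent R₁≡) (afterDescent-descend b _)
  ℓ₁ : lastDescent (afterDescent R) ≡ b
  ℓ₁ = trans (cong lastDescent R₁≡) (lastDescent-descend b _)
  ℓ₂ : lastDescent (afterDescent (afterDescent R)) ≡ a
  ℓ₂ = trans (cong lastDescent R₂≡) (lastDescent-descend a r)
  R₃≡ : afterDescent (afterDescent (afterDescent R)) ≡ r
  R₃≡ = trans (cong afterDescent R₂≡) (afterDescent-descend a r)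

module Splice (m k l : ℕ) (k+l≤ : k + l ≤ suc m) where

  𝒟R≤ : Set
  𝒟R≤ = Σ (RevPath (3 * suc m) 0) λ p → counts (proj₁ p) ≤² (k , l)

  grow : List Step → List Step
  grow r = extend (k ∸ proj₁ (counts r)) (l ∸ proj₂ (counts r)) (suc (suc m ∸ (k + l))) (afterDescent r)

  module Grow (x : 𝒟R≤) where
    p = proj₁ x
    r = proj₁ p
    a = k ∸ proj₁ (counts r)
    b = l ∸ proj₂ (counts r)
    c = suc m ∸ (k + l)

    merged : descend (a + b + c) (afterDescent r) ≡ r
    merged = trans (cong (λ t → descend t (afterDescent r))
                      (∸-gaps-sum (proj₁ (proj₂ x)) (proj₂ (proj₂ x)) k+l≤ (counts-lastDescent p)))
                   (descend-lastDescent-afterDescent r (subst (0 <_) (sym (upSteps-RevPath {suc m} p)) (s≤s z≤n)))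

    length-grow : length (grow r) ≡ 3 * (2 + m)
    length-grow = begin
      length (grow r)                              ≡⟨ length-extend a b c _ ⟩
      3 + length (descend (a + b + c) _)           ≡⟨ cong (λ z → 3 + length z) merged ⟩
      3 + length r                                 ≡⟨ cong (3 +_) (proj₁ (proj₂ p)) ⟩
      3 + 3 * suc m                                ≡⟨ *-suc 3 (suc m) ⟨
      3 * (2 + m)                                  ∎
      where open ≡-Reasoning

    valid-grow : T (validRev 0 0 (grow r))
    valid-grow = subst T (sym (trans (validRev-extend a b c _) (cong (validRev 0 0) merged))) (proj₂ (proj₂ p))

    counts-grow : counts (grow r) ≡ (k , l)
    counts-grow = trans (counts-extend a b c _)
      (trans (cong (λ z → (a , b) ⊕ counts z) merged)
             (cong₂ _,_ (m∸n+n≡m (proj₁ (proj₂ x))) (m∸n+n≡m (proj₂ (proj₂ x)))))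

    image : 𝒟R (2 + m) k l
    image = (grow r , length-grow , valid-grow) , counts-grow

  module Shrink (y : 𝒟R (2 + m) k l) where
    P = proj₁ y
    R = proj₁ P
    R₁ = afterDescent R
    R₂ = afterDescent R₁
    a = lastDescent R₂
    b = lastDescent R₁
    c = pred (lastDescent R)
    valid-R : T (validRev 0 0 R)
    valid-R = proj₂ (proj₂ P)

    up : 2 < upSteps R
    up = subst (2 <_) (sym (trans (upSteps-RevPath {2 + m} P) (four+ m))) (s≤s (s≤s (s≤s z≤n)))
      where
      four+ : ∀ m → 2 * (2 + m) ≡ 4 + 2 * m
      four+ = solve-∀

    unshrink : extend a b (suc c) (afterDescent R₂) ≡ R
    unshrink = trans (cong (λ t → extend a b t (afterDescent R₂)) (suc-pred (lastDescent R) {{>-nonZero pos}}))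
                     (extend-lastDescents R up)
      where
      pos : 0 < lastDescent R
      pos = lastDescent-pos R valid-R (<-trans (s≤s z≤n) (<-trans (s≤s (s≤s z≤n)) up))

    length-shrink : length (shrink R) ≡ 3 * suc m
    length-shrink = +-cancelˡ-≡ 3 _ _ (begin
      3 + length (shrink R)                      ≡⟨ length-extend a b c _ ⟨
      length (extend a b (suc c) (afterDescent R₂)) ≡⟨ cong length unshrink ⟩
      length R                                   ≡⟨ proj₁ (proj₂ P) ⟩
      3 * (2 + m)                                ≡⟨ *-suc 3 (suc m) ⟩
      3 + 3 * suc m                              ∎)
      where open ≡-Reasoning

    valid-shrink : T (validRev 0 0 (shrink R))
    valid-shrink = subst T (trans (cong (validRev 0 0) (sym unshrink)) (validRev-extend a b c _)) valid-R

    i = proj₁ (counts (shrink R))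
    j = proj₂ (counts (shrink R))

    counts-split : (a + i , b + j) ≡ (k , l)
    counts-split = trans (sym (counts-extend a b c _)) (trans (cong counts unshrink) (proj₂ y))

    shrunk : RevPath (3 * suc m) 0
    shrunk = shrink R , length-shrink , valid-shrink

    image : 𝒟R≤
    image = shrunk , subst (i ≤_) (cong proj₁ counts-split) (m≤n+m i a)
                   , subst (j ≤_) (cong proj₂ counts-split) (m≤n+m j b)

  𝒟R≤↔𝒟R : 𝒟R≤ ↔ 𝒟R (2 + m) k l
  𝒟R≤↔𝒟R = mk↔ₛ′ Grow.image Shrink.image to∘from from∘to
    where
    from∘to : ∀ x → Shrink.image (Grow.image x) ≡ x
    from∘to x = Σ-≡-irrelevant ≤²-irrelevant (RevPath-≡ (trans (shrink-extend a b c _) merged))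
      where open Grow x

    to∘from : ∀ y → Grow.image (Shrink.image y) ≡ y
    to∘from y = 𝒟R-≡ {2 + m} (begin
      grow (shrink R)
        ≡⟨ cong₂ (λ u v → extend u v (suc (suc m ∸ (k + l))) (afterDescent (shrink R))) a≡ b≡ ⟩
      extend a b (suc (suc m ∸ (k + l))) (afterDescent (shrink R))
        ≡⟨ cong₂ (λ u v → extend a b (suc u) v) c≡ (afterDescent-descend (a + b + c) _) ⟩
      extend a b (suc c) (afterDescent R₂)
        ≡⟨ unshrink ⟩
      R ∎)
      where
      open Shrink y
      open ≡-Reasoning
      k≡ : a + i ≡ k
      k≡ = cong proj₁ counts-split
      l≡ : b + j ≡ l
      l≡ = cong proj₂ counts-split
      a≡ : k ∸ i ≡ a
      a≡ = trans (cong (_∸ i) (sym k≡)) (m+n∸n≡m a i)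
      b≡ : l ∸ j ≡ b
      b≡ = trans (cong (_∸ j) (sym l≡)) (m+n∸n≡m b j)
      total : i + j + (a + b + c) ≡ suc m
      total = trans (cong (i + j +_) (sym (lastDescent-descend (a + b + c) _))) (counts-lastDescent shrunk)
      c≡ : suc m ∸ (k + l) ≡ c
      c≡ = trans (cong₂ (λ u v → suc m ∸ (u + v)) (sym k≡) (sym l≡)) (∸-gap-recover {a} {b} {c} {i} {j} total)

B3-recurrence : ∀ m k l → k + l < 2 + m → B3 (2 + m) k l ≡ Σ≤ k (λ i → Σ≤ l (λ j → B3 (suc m) i j))
B3-recurrence m k l lt = if-true (<⇒<ᵇ lt)

B3-vanish : ∀ m k l → ¬ (k + l < 2 + m) → B3 (2 + m) k l ≡ 0
B3-vanish m k l ¬lt = if-false (λ t → ¬lt (<ᵇ⇒< (k + l) (2 + m) t))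

RevPath-3 : (p : RevPath 3 0) → proj₁ p ≡ D ∷ U ∷ U ∷ []
RevPath-3 (D ∷ U ∷ U ∷ [] , _ , _) = refl
RevPath-3 (U ∷ _ ∷ _ ∷ [] , _ , ())
RevPath-3 (D ∷ D ∷ U ∷ [] , _ , ())
RevPath-3 (D ∷ D ∷ D ∷ [] , _ , ())
RevPath-3 (D ∷ U ∷ D ∷ [] , _ , ())

Fin1↔𝒟R-1-0-0 : Fin 1 ↔ 𝒟R 1 0 0
Fin1↔𝒟R-1-0-0 = mk↔ₛ′ (λ _ → (D ∷ U ∷ U ∷ [] , refl , tt) , refl) (λ _ → 0F)
  (λ x → 𝒟R-≡ {1} (sym (RevPath-3 (proj₁ x)))) (λ { 0F → refl ; (1+F ()) })

Fin-B3↔𝒟R : ∀ m k l → Fin (B3 (suc m) k l) ↔ 𝒟R (suc m) k l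
Fin-B3↔𝒟R zero zero zero = Fin1↔𝒟R-1-0-0
Fin-B3↔𝒟R zero zero (suc l) = Fin0↔ (λ x → <⇒≱ (𝒟R-bound x) (s≤s z≤n))
Fin-B3↔𝒟R zero (suc k) l = Fin0↔ (λ x → <⇒≱ (𝒟R-bound x) (s≤s z≤n))
Fin-B3↔𝒟R (suc m) k l with k + l <? 2 + m
... | no ¬lt =
  subst (λ b → Fin b ↔ 𝒟R (2 + m) k l) (sym (B3-vanish m k l ¬lt)) (Fin0↔ (λ x → ¬lt (𝒟R-bound {suc m} x)))
... | yes lt = begin
  Fin (B3 (2 + m) k l)
    ≡⟨ cong Fin (B3-recurrence m k l lt) ⟩
  Fin (Σ≤ k (λ i → Σ≤ l (λ j → B3 (suc m) i j)))
    ↔⟨ Fin-Σ≤²↔Σ k l (B3 (suc m)) (Fin-B3↔𝒟R m) ⟩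
  Σ (Fin (suc k)) (λ i → Σ (Fin (suc l)) λ j → 𝒟R (suc m) (toℕ i) (toℕ j))
    ↔⟨ Σ-Fin²-fibres↔≤² (counts ∘ proj₁) k l ⟩
  𝒟R≤
    ↔⟨ 𝒟R≤↔𝒟R ⟩
  𝒟R (2 + m) k l ∎
  where
  open EquationalReasoning
  open Splice m k l (s≤s⁻¹ lt)

-- Counting all 2-Dyck paths

pathCount : ℕ → ℕ → ℕ
pathCount zero zero = 1
pathCount (suc g) zero = 0
pathCount zero (suc L) = pathCount 2 L
pathCount (suc g) (suc L) = pathCount (3 + g) L + pathCount g L

Fin-pathCount↔RevPath : ∀ L g → Fin (pathCount g L) ↔ RevPath L g
Fin-pathCount↔RevPath zero zero =
  mk↔ₛ′ (λ _ → [] , refl , tt) (λ _ → 0F) (λ p → RevPath-≡ (sym (empty p))) (λ { 0F → refl ; (1+F ()) })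
  where
  empty : (p : RevPath 0 0) → proj₁ p ≡ []
  empty ([] , _ , _) = refl
Fin-pathCount↔RevPath zero (suc g) = Fin0↔ λ { ([] , _ , ()) }
Fin-pathCount↔RevPath (suc L) zero = ↔-trans (Fin-pathCount↔RevPath L 2) (mk↔ₛ′ to from to∘from from∘to)
  where
  to : RevPath L 2 → RevPath (suc L) 0
  to (r , len , valid) = D ∷ r , cong suc len , valid
  from : RevPath (suc L) 0 → RevPath L 2
  from (D ∷ r , len , valid) = r , suc-injective len , valid
  to∘from : ∀ p → to (from p) ≡ p
  to∘from (D ∷ r , _) = RevPath-≡ refl
  from∘to : ∀ p → from (to p) ≡ p
  from∘to _ = RevPath-≡ refl
Fin-pathCount↔RevPath (suc L) (suc g) =
  ↔-trans +↔⊎ (↔-trans (Fin-pathCount↔RevPath L (3 + g) ⊎-↔ Fin-pathCount↔RevPath L g)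
                       (mk↔ₛ′ to from to∘from from∘to))
  where
  to : RevPath L (3 + g) ⊎ RevPath L g → RevPath (suc L) (suc g)
  to (inj₁ (r , len , valid)) = D ∷ r , cong suc len , valid
  to (inj₂ (r , len , valid)) = U ∷ r , cong suc len , valid
  from : RevPath (suc L) (suc g) → RevPath L (3 + g) ⊎ RevPath L g
  from (D ∷ r , len , valid) = inj₁ (r , suc-injective len , valid)
  from (U ∷ r , len , valid) = inj₂ (r , suc-injective len , valid)
  to∘from : ∀ p → to (from p) ≡ p
  to∘from (D ∷ r , _) = RevPath-≡ refl
  to∘from (U ∷ r , _) = RevPath-≡ refl
  from∘to : ∀ p → from (to p) ≡ p
  from∘to (inj₁ _) = cong inj₁ (RevPath-≡ refl)
  from∘to (inj₂ _) = cong inj₂ (RevPath-≡ refl)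

C-absorption : ∀ m k → suc k * (suc m C suc k) ≡ suc m * (m C k)
C-absorption zero zero = refl
C-absorption zero (suc k) = *-zeroʳ (2 + k)
C-absorption (suc m) zero = trans (+-identityʳ _) (trans (nC1≡n (2 + m)) (sym (*-identityʳ (2 + m))))
C-absorption (suc m) (suc k) = begin
  (2 + k) * ((2 + m) C (2 + k))                       ≡⟨ cong ((2 + k) *_) (nCk+nC[k+1]≡[n+1]C[k+1] (suc m) (suc k)) ⟨
  (2 + k) * (A + B)                                   ≡⟨ regroup k A B ⟩
  A + (suc k * A + (2 + k) * B)
    ≡⟨ cong₂ (λ u v → A + (u + v)) (C-absorption m k) (C-absorption m (suc k)) ⟩
  A + (suc m * (m C k) + suc m * (m C suc k))         ≡⟨ cong (A +_) (*-distribˡ-+ (suc m) (m C k) (m C suc k)) ⟨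
  A + suc m * (m C k + m C suc k)                     ≡⟨ cong (λ z → A + suc m * z) (nCk+nC[k+1]≡[n+1]C[k+1] m k) ⟩
  A + suc m * A                                       ∎
  where
  open ≡-Reasoning
  A = suc m C suc k
  B = suc m C (2 + k)
  regroup : ∀ k a b → (2 + k) * (a + b) ≡ a + (suc k * a + (2 + k) * b)
  regroup = solve-∀

C-absorption′ : ∀ m k → suc k * (m C suc k) + suc k * (m C k) ≡ suc m * (m C k)
C-absorption′ m k = begin
  suc k * (m C suc k) + suc k * (m C k)   ≡⟨ *-distribˡ-+ (suc k) (m C suc k) (m C k) ⟨
  suc k * (m C suc k + m C k)             ≡⟨ cong (suc k *_) (+-comm (m C suc k) (m C k)) ⟩
  suc k * (m C k + m C suc k)             ≡⟨ cong (suc k *_) (nCk+nC[k+1]≡[n+1]C[k+1] m k) ⟩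
  suc k * (suc m C suc k)                 ≡⟨ C-absorption m k ⟩
  suc m * (m C k)                         ∎
  where open ≡-Reasoning

C-3d+2 : ∀ d → 2 * ((3 * d + 2) C d) ≡ (3 * d + 2) C suc d
C-3d+2 d = *-cancelˡ-≡ _ _ (suc d) (+-cancelʳ-≡ (suc d * X) _ _ (begin
  suc d * (2 * X) + suc d * X             ≡⟨ regroup d X ⟨
  suc (3 * d + 2) * X                     ≡⟨ C-absorption′ (3 * d + 2) d ⟨
  suc d * ((3 * d + 2) C suc d) + suc d * X ∎))
  where
  open ≡-Reasoning
  X = (3 * d + 2) C d
  regroup : ∀ d x → suc (3 * d + 2) * x ≡ suc d * (2 * x) + suc d * x
  regroup = solve-∀

C-pred : ℕ → ℕ → ℕ
C-pred L zero = 0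
C-pred L (suc d) = L C d

C-pred-pascal : ∀ L d → C-pred (suc L) (suc d) ≡ C-pred L d + L C d
C-pred-pascal L zero = refl
C-pred-pascal L (suc d) = sym (nCk+nC[k+1]≡[n+1]C[k+1] L d)

pathCount-vanish : ∀ g L → L < g → pathCount g L ≡ 0
pathCount-vanish (suc g) zero _ = refl
pathCount-vanish (suc g) (suc L) (s≤s L<g) =
  cong₂ _+_ (pathCount-vanish (3 + g) L (m<n⇒m<o+n 3 L<g)) (pathCount-vanish g L L<g)
  where
  m<n⇒m<o+n : ∀ o {m n} → m < n → m < o + n
  m<n⇒m<o+n o {m} {n} m<n = ≤-trans m<n (m≤n+m n o)

pathCount-diag : ∀ g → pathCount g g ≡ 1
pathCount-diag zero = refl
pathCount-diag (suc g) = cong₂ _+_ (pathCount-vanish (3 + g) g (m≤n+m (suc g) 2)) (pathCount-diag g)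

-- Ballot-type count: a path read from height g down to 0 in L = g + 3d steps has d steps D.
pathCount-ballot : ∀ L g d → g + 3 * d ≡ L → pathCount g L + 2 * C-pred L d ≡ L C d
pathCount-ballot zero zero zero _ = refl
pathCount-ballot (suc L) g zero e =
  trans (+-identityʳ _) (trans (cong (λ h → pathCount h (suc L)) (trans (sym (+-identityʳ g)) e)) (pathCount-diag (suc L)))
pathCount-ballot (suc L) zero (suc d) e = begin
  pathCount 2 L + 2 * C-pred (suc L) (suc d)          ≡⟨ cong (λ z → pathCount 2 L + 2 * z) (C-pred-pascal L d) ⟩
  pathCount 2 L + 2 * (C-pred L d + L C d)            ≡⟨ regroup (pathCount 2 L) (C-pred L d) (L C d) ⟩
  (pathCount 2 L + 2 * C-pred L d) + 2 * (L C d)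
    ≡⟨ cong₂ _+_ (pathCount-ballot L 2 d L≡) (subst (λ z → 2 * (z C d) ≡ z C suc d) L≡′ (C-3d+2 d)) ⟩
  L C d + L C suc d                                   ≡⟨ nCk+nC[k+1]≡[n+1]C[k+1] L d ⟩
  suc L C suc d                                       ∎
  where
  open ≡-Reasoning
  regroup : ∀ x y z → x + 2 * (y + z) ≡ (x + 2 * y) + 2 * z
  regroup = solve-∀
  shift : ∀ d → 3 * suc d ≡ suc (2 + 3 * d)
  shift = solve-∀
  L≡ : 2 + 3 * d ≡ L
  L≡ = suc-injective (trans (sym (shift d)) e)
  L≡′ : 3 * d + 2 ≡ L
  L≡′ = trans (+-comm (3 * d) 2) L≡
pathCount-ballot (suc L) (suc g) (suc d) e = begin
  pathCount (3 + g) L + pathCount g L + 2 * C-pred (suc L) (suc d)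
    ≡⟨ cong (λ z → pathCount (3 + g) L + pathCount g L + 2 * z) (C-pred-pascal L d) ⟩
  pathCount (3 + g) L + pathCount g L + 2 * (C-pred L d + L C d)
    ≡⟨ regroup (pathCount (3 + g) L) (pathCount g L) (C-pred L d) (L C d) ⟩
  (pathCount (3 + g) L + 2 * C-pred L d) + (pathCount g L + 2 * (L C d))
    ≡⟨ cong₂ _+_ (pathCount-ballot L (3 + g) d (suc-injective (trans (shift g d) e)))
                 (pathCount-ballot L g (suc d) (suc-injective e)) ⟩
  L C d + L C suc d
    ≡⟨ nCk+nC[k+1]≡[n+1]C[k+1] L d ⟩
  suc L C suc d ∎
  where
  open ≡-Reasoning
  regroup : ∀ x y u v → x + y + 2 * (u + v) ≡ (x + 2 * u) + (y + 2 * v)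
  regroup = solve-∀
  shift : ∀ g d → suc (3 + g + 3 * d) ≡ suc g + 3 * suc d
  shift = solve-∀

pathCount-2-Dyck : ∀ m → pathCount 0 (3 * suc m) * suc (2 * suc m) ≡ (3 * suc m) C suc m
pathCount-2-Dyck m = begin
  X * suc (2 * n)  ≡⟨ regroup n X ⟩
  X + 2 * (n * X)  ≡⟨ cong (λ z → X + 2 * z) nX≡Y ⟩
  X + 2 * Y        ≡⟨ ballot ⟩
  Z                ∎
  where
  open ≡-Reasoning
  n = suc m
  X = pathCount 0 (3 * n)
  Y = (3 * n) C m
  Z = (3 * n) C n
  ballot : X + 2 * Y ≡ Z
  ballot = pathCount-ballot (3 * n) 0 n refl
  regroup : ∀ n x → x * suc (2 * n) ≡ x + 2 * (n * x)
  regroup = solve-∀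
  expand : ∀ n x y → n * (x + 2 * y) + n * y ≡ n * x + 3 * n * y
  expand = solve-∀
  expand′ : ∀ n y → suc (3 * n) * y ≡ y + 3 * n * y
  expand′ = solve-∀
  nX≡Y : n * X ≡ Y
  nX≡Y = +-cancelʳ-≡ (3 * n * Y) _ _ (begin
    n * X + 3 * n * Y          ≡⟨ expand n X Y ⟨
    n * (X + 2 * Y) + n * Y    ≡⟨ cong (λ z → n * z + n * Y) ballot ⟩
    n * Z + n * Y              ≡⟨ C-absorption′ (3 * n) m ⟩
    suc (3 * n) * Y            ≡⟨ expand′ n Y ⟩
    Y + 3 * n * Y              ∎)

C3≡pathCount : ∀ m → C3 (suc m) ≡ pathCount 0 (3 * suc m)
C3≡pathCount m = trans (cong (_/ suc (2 * suc m)) (sym (pathCount-2-Dyck m))) (m*n/n≡m _ (suc (2 * suc m)))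

Fin-totalB3↔RevPath : ∀ m → Fin (totalB3 (suc m)) ↔ RevPath (3 * suc m) 0
Fin-totalB3↔RevPath m = begin
  Fin (totalB3 n)
    ↔⟨ Fin-Σ≤²↔Σ n n (B3 n) (Fin-B3↔𝒟R m) ⟩
  Σ (Fin (suc n)) (λ k → Σ (Fin (suc n)) λ l → 𝒟R n (toℕ k) (toℕ l))
    ↔⟨ Σ-Fin²-fibres↔≤² (counts ∘ proj₁) n n ⟩
  Σ (RevPath (3 * n) 0) (λ p → counts (proj₁ p) ≤² (n , n))
    ↔⟨ Σ-fst↔ bounded ≤²-irrelevant ⟩
  RevPath (3 * n) 0 ∎
  where
  open EquationalReasoning
  n = suc m
  bounded : ∀ p → counts (proj₁ p) ≤² (n , n)
  bounded p = ≤-trans (m≤m+n k l) size≤n , ≤-trans (m≤n+m l k) size≤n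
    where
    k = proj₁ (counts (proj₁ p))
    l = proj₂ (counts (proj₁ p))
    size≤n : k + l ≤ n
    size≤n = subst (k + l ≤_) (counts-lastDescent p) (m≤m+n (k + l) (lastDescent (proj₁ p)))

totalB3≡pathCount : ∀ m → totalB3 (suc m) ≡ pathCount 0 (3 * suc m)
totalB3≡pathCount m = ↔⇒≡ (↔-trans (Fin-totalB3↔RevPath m) (↔-sym (Fin-pathCount↔RevPath (3 * suc m) 0)))

proposition2p1 : (n : ℕ) → 1 ≤ n →
    (totalB3 n ≡ C3 n) ×
    ((k l : ℕ) → k + l < n → Fin (B3 n k l) ↔ 𝒟 n k l)
proposition2p1 (suc m) _ =
  trans (totalB3≡pathCount m) (sym (C3≡pathCount m)) ,
  λ k l _ → ↔-trans (Fin-B3↔𝒟R m k l) (↔-sym (𝒟↔𝒟R (suc m) k l))
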